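{- Let $m\ge1$ and define $\binom{n}{k}_m$ for $0\le k\le n$ by $\binom{n}{0}_m=1$, $\binom{n}{n}_m=\delta_{n\bmod m,0}$ (for all $n\ge0$), and $\binom{n}{k}_m=\binom{n-1}{k}_m+\binom{n-1}{k-1}_m$ for $0<k<n$. Let $a_n=\sum_{k=0}^{\lfloor n/2\rfloor}\binom{n-k}{k}_m$ be the sum of the $n$-th antidiagonal. Then \[ \sum_{n\ge0}a_nx^n=\frac{1-x^2}{(1-x^{2m})(1-x-x^2)}=\frac{1}{(1+x^2+\cdots+x^{2(m-1)})(1-x-x^2)}. \]
   Context: $\delta_{i,j}$ is $1$ if $i=j$ and $0$ otherwise. -}

module Defs where

open import Data.Nat as N using (ℕ; zero; suc; _∸_; _%_; _/_; NonZero; _<?_; _≟_)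
open import Data.Integer as ℤ using (ℤ; +_; _+_; _*_; -_; 0ℤ; 1ℤ)
open import Relation.Nullary using (yes; no)

δ0 : ℕ → ℕ
δ0 zero    = 1
δ0 (suc _) = 0

-- mbinom m n k = (n choose k)_m for 0 ≤ k ≤ n; set to 0 outside that range
-- (out-of-range values are never used by the recurrence or by a_n).
--   (n,0)_m = 1 ;  (n,n)_m = δ_{n mod m, 0} ;  (n,k)_m = (n-1,k)_m + (n-1,k-1)_m  for 0<k<n
mbinom : (m : ℕ) → .{{NonZero m}} → ℕ → ℕ → ℕ
mbinom m n       zero    = 1
mbinom m zero    (suc k) = 0
mbinom m (suc n) (suc k) with suc k ≟ suc n
... | yes _ = δ0 (suc n % m)
... | no  _ with k <? n
...   | yes _ = mbinom m n (suc k) N.+ mbinom m n k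

...   | no  _ = 0

sumTo : ℕ → (ℕ → ℤ) → ℤ
sumTo zero    f = f 0
sumTo (suc n) f = sumTo n f + f (suc n)

antidiag : (m : ℕ) → .{{NonZero m}} → ℕ → ℤ
antidiag m n = sumTo (n / 2) (λ k → + mbinom m (n ∸ k) k)

Series : Set
Series = ℕ → ℤ

_⊕_ : Series → Series → Series
(f ⊕ g) n = f n + g n

⊖_ : Series → Series
(⊖ f) n = - f n

_⊛_ : Series → Series → Series
(f ⊛ g) n = sumTo n (λ i → f i * g (n ∸ i))

infixl 6 _⊕_
infixl 7 _⊛_
infix 8 ⊖_

X^ : ℕ → Series
X^ k n with k ≟ n
... | yes _ = 1ℤ
... | no  _ = 0ℤ

one : Series
one = X^ 0

evenGeom : ℕ → Series
evenGeom zero    = λ _ → 0ℤ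
evenGeom (suc j) = evenGeom j ⊕ X^ (2 N.* j)

-- Let c = a·(1 − x − x²), where a = Σ aₙ xⁿ. Summing Pascal's rule along an antidiagonal gives
-- aₙ₊₂ = aₙ₊₁ + aₙ, except that the rule fails on the diagonal, where (s choose s)_m is the
-- indicator of m ∣ s instead of the sum of its two neighbours. Collecting these defects gives
-- c = (1 − x²)·E(x²) with E = Σ_{m ∣ t} xᵗ. Since (1 − xᵐ)·E = 1, multiplying c by 1 − x^{2m}
-- leaves 1 − x², and multiplying it by 1 + x² + ⋯ + x^{2(m−1)} telescopes to 1.

module Submission where

open import Defs
open import Data.Empty using (⊥-elim)
open import Data.Integer as ℤ using (ℤ; +_; _+_; _-_; -_; 0ℤ; 1ℤ)
import Data.Integer.Properties as ℤₚ
open import Data.Integer.Tactic.RingSolver using (solve-∀)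
open import Data.Nat as ℕ using (ℕ; zero; suc; _*_; _∸_; _≤_; _<_; z≤n; s≤s; _%_; _/_; NonZero)
import Data.Nat.Properties as ℕₚ
open import Data.Nat.DivMod using (m<n⇒m%n≡m; [m+n]%n≡m%n; m*n/n≡m; /-monoˡ-≤; m/n≤m)
open import Data.Product using (_×_; _,_)
open import Data.Sum using (inj₁; inj₂)
open import Function using (_∘_)
open import Relation.Binary.PropositionalEquality
open import Relation.Binary.Definitions using (tri<; tri≈; tri>)
open import Relation.Nullary using (yes; no)

open ≡-Reasoning

sumTo-cong : ∀ n {f g : ℕ → ℤ} → (∀ {i} → i ≤ n → f i ≡ g i) → sumTo n f ≡ sumTo n g
sumTo-cong zero    f≡g = f≡g z≤n
sumTo-cong (suc n) f≡g = cong₂ _+_ (sumTo-cong n (f≡g ∘ ℕₚ.m≤n⇒m≤1+n)) (f≡g ℕₚ.≤-refl)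

sumTo-zero : ∀ n {f : ℕ → ℤ} → (∀ {i} → i ≤ n → f i ≡ 0ℤ) → sumTo n f ≡ 0ℤ
sumTo-zero zero    f≡0 = f≡0 z≤n
sumTo-zero (suc n) f≡0 = cong₂ _+_ (sumTo-zero n (f≡0 ∘ ℕₚ.m≤n⇒m≤1+n)) (f≡0 ℕₚ.≤-refl)

sumTo-+ : ∀ n (f g : ℕ → ℤ) → sumTo n (λ i → f i + g i) ≡ sumTo n f + sumTo n g
sumTo-+ zero    f g = refl
sumTo-+ (suc n) f g = trans (cong (_+ (f (suc n) + g (suc n))) (sumTo-+ n f g))
                            (interchange (sumTo n f) (sumTo n g) (f (suc n)) (g (suc n)))
  where
  interchange : ∀ a b c d → (a + b) + (c + d) ≡ (a + c) + (b + d)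
  interchange = solve-∀

sumTo-neg : ∀ n (f : ℕ → ℤ) → sumTo n (λ i → - f i) ≡ - sumTo n f
sumTo-neg zero    f = refl
sumTo-neg (suc n) f = trans (cong (_+ - f (suc n)) (sumTo-neg n f))
                            (sym (ℤₚ.neg-distrib-+ (sumTo n f) (f (suc n))))

sumTo-head : ∀ n (f : ℕ → ℤ) → sumTo (suc n) f ≡ f 0 + sumTo n (f ∘ suc)
sumTo-head zero    f = refl
sumTo-head (suc n) f = trans (cong (_+ f (suc (suc n))) (sumTo-head n f))
                             (ℤₚ.+-assoc (f 0) (sumTo n (f ∘ suc)) (f (suc (suc n))))

sumTo-extend : ∀ {h n} (f : ℕ → ℤ) → h ≤ n → (∀ {k} → h < k → k ≤ n → f k ≡ 0ℤ) →
               sumTo h f ≡ sumTo n f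
sumTo-extend {n = zero}  f z≤n _ = refl
sumTo-extend {h} {suc n} f h≤1+n vanish with ℕₚ.m≤n⇒m<n∨m≡n h≤1+n
... | inj₂ refl        = refl
... | inj₁ (s≤s h≤n) = begin
  sumTo h f                      ≡⟨ sumTo-extend f h≤n (λ h<k k≤n → vanish h<k (ℕₚ.m≤n⇒m≤1+n k≤n)) ⟩
  sumTo n f                      ≡⟨ sym (ℤₚ.+-identityʳ _) ⟩
  sumTo n f + 0ℤ                 ≡⟨ cong (λ x → sumTo n f + x) (sym (vanish (s≤s h≤n) ℕₚ.≤-refl)) ⟩
  sumTo (suc n) f                ∎

X^-diag : ∀ k → X^ k k ≡ 1ℤ
X^-diag k with k ℕ.≟ k
... | yes _   = refl
... | no k≢k = ⊥-elim (k≢k refl)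

X^-off : ∀ {k n} → k ≢ n → X^ k n ≡ 0ℤ
X^-off {k} {n} k≢n with k ℕ.≟ n
... | yes k≡n = ⊥-elim (k≢n k≡n)
... | no _    = refl

+-X^-off : ∀ {k n} → k ≢ n → ∀ x y → x + X^ k n ℤ.* y ≡ x
+-X^-off k≢n x y = trans (cong (λ z → x + z ℤ.* y) (X^-off k≢n)) (ℤₚ.+-identityʳ x)

X^-suc : ∀ k n → X^ (suc k) (suc n) ≡ X^ k n
X^-suc k n with k ℕ.≟ n
... | yes refl = X^-diag (suc k)
... | no k≢n  = X^-off (k≢n ∘ ℕₚ.suc-injective)

+δ0≡one : ∀ n → + δ0 n ≡ one n
+δ0≡one zero    = refl
+δ0≡one (suc n) = refl

shift : ℕ → Series → Series
shift zero    f n       = f n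
shift (suc k) f zero    = 0ℤ
shift (suc k) f (suc n) = shift k f n

shift-cong : ∀ k {f g : Series} → f ≗ g → shift k f ≗ shift k g
shift-cong zero    f≗g n       = f≗g n
shift-cong (suc k) f≗g zero    = refl
shift-cong (suc k) f≗g (suc n) = shift-cong k f≗g n

shift-shift : ∀ i j (f : Series) → shift i (shift j f) ≗ shift (i ℕ.+ j) f
shift-shift zero    j f n       = refl
shift-shift (suc i) j f zero    = refl
shift-shift (suc i) j f (suc n) = shift-shift i j f n

shift-comm : ∀ i j (f : Series) → shift i (shift j f) ≗ shift j (shift i f)
shift-comm i j f n = begin
  shift i (shift j f) n ≡⟨ shift-shift i j f n ⟩
  shift (i ℕ.+ j) f n   ≡⟨ cong (λ k → shift k f n) (ℕₚ.+-comm i j) ⟩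
  shift (j ℕ.+ i) f n   ≡⟨ sym (shift-shift j i f n) ⟩
  shift j (shift i f) n ∎

shift-sub : ∀ k (f g : Series) → shift k (f ⊕ ⊖ g) ≗ shift k f ⊕ ⊖ shift k g
shift-sub zero    f g n       = refl
shift-sub (suc k) f g zero    = refl
shift-sub (suc k) f g (suc n) = shift-sub k f g n

shift-below : ∀ {k n} (f : Series) → n < k → shift k f n ≡ 0ℤ
shift-below {suc k} {zero}  f _         = refl
shift-below {suc k} {suc n} f (s≤s n<k) = shift-below f n<k

shift-+ : ∀ k (f : Series) n → shift k f (k ℕ.+ n) ≡ f n
shift-+ zero    f n = refl
shift-+ (suc k) f n = shift-+ k f n

X^≗shift-one : ∀ k → X^ k ≗ shift k one
X^≗shift-one zero    n       = refl
X^≗shift-one (suc k) zero    = refl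
X^≗shift-one (suc k) (suc n) = trans (X^-suc k n) (X^≗shift-one k n)

∇ : ℕ → Series → Series
∇ k f = f ⊕ ⊖ shift k f

∇-cong : ∀ k {f g : Series} → f ≗ g → ∇ k f ≗ ∇ k g
∇-cong k f≗g n = cong₂ _-_ (f≗g n) (shift-cong k f≗g n)

∇-comm : ∀ i j (f : Series) → ∇ i (∇ j f) ≗ ∇ j (∇ i f)
∇-comm i j f n = begin
  (f n - shift j f n) - shift i (∇ j f) n
    ≡⟨ cong (λ x → (f n - shift j f n) - x) (shift-sub i f (shift j f) n) ⟩
  (f n - shift j f n) - (shift i f n - shift i (shift j f) n)
    ≡⟨ cong (λ x → (f n - shift j f n) - (shift i f n - x)) (shift-comm i j f n) ⟩
  (f n - shift j f n) - (shift i f n - shift j (shift i f) n)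
    ≡⟨ swap (f n) (shift j f n) (shift i f n) (shift j (shift i f) n) ⟩
  (f n - shift i f n) - (shift j f n - shift j (shift i f) n)
    ≡⟨ cong (λ x → (f n - shift i f n) - x) (sym (shift-sub j f (shift i f) n)) ⟩
  (f n - shift i f n) - shift j (∇ i f) n ∎
  where
  swap : ∀ a b c d → (a - b) - (c - d) ≡ (a - c) - (b - d)
  swap = solve-∀

⊛-congʳ : ∀ (f : Series) {g h : Series} → g ≗ h → f ⊛ g ≗ f ⊛ h
⊛-congʳ f g≗h n = sumTo-cong n (λ {i} _ → cong (f i ℤ.*_) (g≗h (n ∸ i)))

⊛-distribˡ-⊕ : ∀ (f g h : Series) → f ⊛ (g ⊕ h) ≗ f ⊛ g ⊕ f ⊛ h
⊛-distribˡ-⊕ f g h n =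
  trans (sumTo-cong n (λ {i} _ → ℤₚ.*-distribˡ-+ (f i) (g (n ∸ i)) (h (n ∸ i)))) (sumTo-+ n _ _)

⊛-distribʳ-⊕ : ∀ (f g h : Series) → (f ⊕ g) ⊛ h ≗ f ⊛ h ⊕ g ⊛ h
⊛-distribʳ-⊕ f g h n =
  trans (sumTo-cong n (λ {i} _ → ℤₚ.*-distribʳ-+ (h (n ∸ i)) (f i) (g i))) (sumTo-+ n _ _)

⊛-negʳ : ∀ (f g : Series) → f ⊛ ⊖ g ≗ ⊖ (f ⊛ g)
⊛-negʳ f g n =
  trans (sumTo-cong n (λ {i} _ → sym (ℤₚ.neg-distribʳ-* (f i) (g (n ∸ i))))) (sumTo-neg n _)

⊛-negˡ : ∀ (f g : Series) → ⊖ f ⊛ g ≗ ⊖ (f ⊛ g)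
⊛-negˡ f g n =
  trans (sumTo-cong n (λ {i} _ → sym (ℤₚ.neg-distribˡ-* (f i) (g (n ∸ i))))) (sumTo-neg n _)

⊛-identityʳ : ∀ (f : Series) → f ⊛ one ≗ f
⊛-identityʳ f zero    = ℤₚ.*-identityʳ (f 0)
⊛-identityʳ f (suc n) = begin
  sumTo n (λ i → f i ℤ.* one (suc n ∸ i)) + f (suc n) ℤ.* one (n ∸ n)
    ≡⟨ cong₂ _+_ (sumTo-zero n λ {i} i≤n → trans (cong (λ j → f i ℤ.* one j) (ℕₚ.+-∸-assoc 1 i≤n))
                                                 (ℤₚ.*-zeroʳ (f i)))
                 (cong (λ j → f (suc n) ℤ.* one j) (ℕₚ.n∸n≡0 n)) ⟩
  0ℤ + f (suc n) ℤ.* 1ℤ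
    ≡⟨ trans (ℤₚ.+-identityˡ _) (ℤₚ.*-identityʳ _) ⟩
  f (suc n) ∎

⊛-identityˡ : ∀ (g : Series) → one ⊛ g ≗ g
⊛-identityˡ g zero    = ℤₚ.*-identityˡ (g 0)
⊛-identityˡ g (suc n) = begin
  (one ⊛ g) (suc n)                      ≡⟨ sumTo-head n _ ⟩
  1ℤ ℤ.* g (suc n) + sumTo n (λ _ → 0ℤ) ≡⟨ cong₂ _+_ (ℤₚ.*-identityˡ (g (suc n))) (sumTo-zero n (λ _ → refl)) ⟩
  g (suc n) + 0ℤ                         ≡⟨ ℤₚ.+-identityʳ _ ⟩
  g (suc n)                              ∎

⊛-shiftʳ : ∀ k (f g : Series) → f ⊛ shift k g ≗ shift k (f ⊛ g)
⊛-shiftʳ zero    f g n       = refl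
⊛-shiftʳ (suc k) f g zero    = ℤₚ.*-zeroʳ (f 0)
⊛-shiftʳ (suc k) f g (suc n) = begin
  sumTo n (λ i → f i ℤ.* shift (suc k) g (suc n ∸ i)) + f (suc n) ℤ.* shift (suc k) g (n ∸ n)
    ≡⟨ cong₂ _+_ (sumTo-cong n λ {i} i≤n → cong (λ j → f i ℤ.* shift (suc k) g j) (ℕₚ.+-∸-assoc 1 i≤n))
                 (trans (cong (λ j → f (suc n) ℤ.* shift (suc k) g j) (ℕₚ.n∸n≡0 n)) (ℤₚ.*-zeroʳ (f (suc n)))) ⟩
  (f ⊛ shift k g) n + 0ℤ
    ≡⟨ ℤₚ.+-identityʳ _ ⟩
  (f ⊛ shift k g) n
    ≡⟨ ⊛-shiftʳ k f g n ⟩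
  shift k (f ⊛ g) n ∎

⊛-shiftˡ : ∀ k (f g : Series) → shift k f ⊛ g ≗ shift k (f ⊛ g)
⊛-shiftˡ zero    f g n       = refl
⊛-shiftˡ (suc k) f g zero    = refl
⊛-shiftˡ (suc k) f g (suc n) =
  trans (sumTo-head n _) (trans (ℤₚ.+-identityˡ _) (⊛-shiftˡ k f g n))

⊛-X^ʳ : ∀ (f : Series) k → f ⊛ X^ k ≗ shift k f
⊛-X^ʳ f k n = begin
  (f ⊛ X^ k) n         ≡⟨ ⊛-congʳ f (X^≗shift-one k) n ⟩
  (f ⊛ shift k one) n  ≡⟨ ⊛-shiftʳ k f one n ⟩
  shift k (f ⊛ one) n  ≡⟨ shift-cong k (⊛-identityʳ f) n ⟩
  shift k f n          ∎

⊛-X^ˡ : ∀ k (g : Series) → X^ k ⊛ g ≗ shift k g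
⊛-X^ˡ k g n = begin
  (X^ k ⊛ g) n         ≡⟨ sumTo-cong n (λ {i} _ → cong (ℤ._* g (n ∸ i)) (X^≗shift-one k i)) ⟩
  (shift k one ⊛ g) n  ≡⟨ ⊛-shiftˡ k one g n ⟩
  shift k (one ⊛ g) n  ≡⟨ shift-cong k (⊛-identityˡ g) n ⟩
  shift k g n          ∎

⊛-∇ʳ : ∀ k (f g : Series) → f ⊛ ∇ k g ≗ ∇ k (f ⊛ g)
⊛-∇ʳ k f g n = begin
  (f ⊛ (g ⊕ ⊖ shift k g)) n          ≡⟨ ⊛-distribˡ-⊕ f g (⊖ shift k g) n ⟩
  (f ⊛ g) n + (f ⊛ ⊖ shift k g) n    ≡⟨ cong (λ x → (f ⊛ g) n + x) (⊛-negʳ f (shift k g) n) ⟩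
  (f ⊛ g) n - (f ⊛ shift k g) n      ≡⟨ cong (λ x → (f ⊛ g) n - x) (⊛-shiftʳ k f g n) ⟩
  ∇ k (f ⊛ g) n                      ∎

one-X^-⊛ : ∀ k (g : Series) → (one ⊕ ⊖ X^ k) ⊛ g ≗ ∇ k g
one-X^-⊛ k g n = begin
  ((one ⊕ ⊖ X^ k) ⊛ g) n             ≡⟨ ⊛-distribʳ-⊕ one (⊖ X^ k) g n ⟩
  (one ⊛ g) n + (⊖ X^ k ⊛ g) n       ≡⟨ cong₂ _+_ (⊛-identityˡ g n) (⊛-negˡ (X^ k) g n) ⟩
  g n - (X^ k ⊛ g) n                 ≡⟨ cong (λ x → g n - x) (⊛-X^ˡ k g n) ⟩
  ∇ k g n                            ∎

⊛-by-1-x-x² : ∀ (f : Series) n → (f ⊛ (one ⊕ ⊖ X^ 1 ⊕ ⊖ X^ 2)) n ≡ f n - shift 1 f n - shift 2 f n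
⊛-by-1-x-x² f n = begin
  (f ⊛ (one ⊕ ⊖ X^ 1 ⊕ ⊖ X^ 2)) n
    ≡⟨ ⊛-distribˡ-⊕ f (one ⊕ ⊖ X^ 1) (⊖ X^ 2) n ⟩
  (f ⊛ (one ⊕ ⊖ X^ 1)) n + (f ⊛ ⊖ X^ 2) n
    ≡⟨ cong₂ _+_ (⊛-distribˡ-⊕ f one (⊖ X^ 1) n) (⊛-negʳ f (X^ 2) n) ⟩
  ((f ⊛ one) n + (f ⊛ ⊖ X^ 1) n) - (f ⊛ X^ 2) n
    ≡⟨ cong₂ (λ x y → (x + y) - (f ⊛ X^ 2) n) (⊛-identityʳ f n) (⊛-negʳ f (X^ 1) n) ⟩
  f n - (f ⊛ X^ 1) n - (f ⊛ X^ 2) n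
    ≡⟨ cong₂ (λ x y → f n - x - y) (⊛-X^ʳ f 1 n) (⊛-X^ʳ f 2 n) ⟩
  f n - shift 1 f n - shift 2 f n ∎

⊛-evenGeom-⊛ : ∀ j (f g e : Series) → f ⊛ g ≗ ∇ 2 e → f ⊛ (evenGeom j ⊛ g) ≗ ∇ (2 * j) e
⊛-evenGeom-⊛ zero f g e _ n = begin
  (f ⊛ (evenGeom 0 ⊛ g)) n
    ≡⟨ sumTo-zero n (λ {i} _ → trans (cong (f i ℤ.*_) (sumTo-zero (n ∸ i) (λ _ → refl))) (ℤₚ.*-zeroʳ (f i))) ⟩
  0ℤ
    ≡⟨ sym (ℤₚ.+-inverseʳ (e n)) ⟩
  ∇ 0 e n ∎
⊛-evenGeom-⊛ (suc j) f g e f⊛g≗∇e n = begin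
  (f ⊛ ((evenGeom j ⊕ X^ (2 * j)) ⊛ g)) n
    ≡⟨ ⊛-congʳ f (λ l → trans (⊛-distribʳ-⊕ (evenGeom j) (X^ (2 * j)) g l)
                              (cong (λ x → (evenGeom j ⊛ g) l + x) (⊛-X^ˡ (2 * j) g l))) n ⟩
  (f ⊛ (evenGeom j ⊛ g ⊕ shift (2 * j) g)) n
    ≡⟨ ⊛-distribˡ-⊕ f (evenGeom j ⊛ g) (shift (2 * j) g) n ⟩
  (f ⊛ (evenGeom j ⊛ g)) n + (f ⊛ shift (2 * j) g) n
    ≡⟨ cong₂ _+_ (⊛-evenGeom-⊛ j f g e f⊛g≗∇e n)
                 (trans (⊛-shiftʳ (2 * j) f g n) (shift-cong (2 * j) f⊛g≗∇e n)) ⟩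
  ∇ (2 * j) e n + shift (2 * j) (∇ 2 e) n
    ≡⟨ cong (λ x → ∇ (2 * j) e n + x) (shift-sub (2 * j) e (shift 2 e) n) ⟩
  (e n - shift (2 * j) e n) + (shift (2 * j) e n - shift (2 * j) (shift 2 e) n)
    ≡⟨ ℤₚ.+-minus-telescope (e n) (shift (2 * j) e n) _ ⟩
  e n - shift (2 * j) (shift 2 e) n
    ≡⟨ cong (λ x → e n - x) (shift-shift (2 * j) 2 e n) ⟩
  e n - shift (2 * j ℕ.+ 2) e n
    ≡⟨ cong (λ k → e n - shift k e n) (trans (ℕₚ.+-comm (2 * j) 2) (sym (ℕₚ.*-suc 2 j))) ⟩
  ∇ (2 * suc j) e n ∎

-- dilate g = g(x²): the factor X^ k (n ∸ k) selects the single term with k + k = n.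
dilate : Series → Series
dilate g n = sumTo n (λ k → X^ k (n ∸ k) ℤ.* g k)

dilate-cong : ∀ {f g : Series} → f ≗ g → dilate f ≗ dilate g
dilate-cong f≗g n = sumTo-cong n (λ {k} _ → cong (X^ k (n ∸ k) ℤ.*_) (f≗g k))

dilate-sub : ∀ (f g : Series) → dilate (f ⊕ ⊖ g) ≗ dilate f ⊕ ⊖ dilate g
dilate-sub f g n = begin
  sumTo n (λ k → x k ℤ.* (f k - g k))
    ≡⟨ sumTo-cong n (λ {k} _ → trans (ℤₚ.*-distribˡ-+ (x k) (f k) (- g k))
                                     (cong (λ y → x k ℤ.* f k + y) (sym (ℤₚ.neg-distribʳ-* (x k) (g k))))) ⟩
  sumTo n (λ k → x k ℤ.* f k + - (x k ℤ.* g k))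
    ≡⟨ sumTo-+ n _ _ ⟩
  dilate f n + sumTo n (λ k → - (x k ℤ.* g k))
    ≡⟨ cong (λ y → dilate f n + y) (sumTo-neg n _) ⟩
  dilate f n - dilate g n ∎
  where
  x : ℕ → ℤ
  x k = X^ k (n ∸ k)

dilate-0 : ∀ (g : Series) → dilate g 0 ≡ g 0
dilate-0 g = ℤₚ.*-identityˡ (g 0)

dilate-1 : ∀ (g : Series) → dilate g 1 ≡ 0ℤ
dilate-1 g = refl

dilate-suc-suc : ∀ (g : Series) n → dilate g (suc (suc n)) ≡ dilate (g ∘ suc) n
dilate-suc-suc g n = begin
  dilate g (suc (suc n))
    ≡⟨ sumTo-head (suc n) _ ⟩
  0ℤ + (sumTo n (λ k → X^ (suc k) (suc n ∸ k) ℤ.* g (suc k)) + X^ (suc (suc n)) (n ∸ n) ℤ.* g (suc (suc n)))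
    ≡⟨ ℤₚ.+-identityˡ _ ⟩
  sumTo n (λ k → X^ (suc k) (suc n ∸ k) ℤ.* g (suc k)) + X^ (suc (suc n)) (n ∸ n) ℤ.* g (suc (suc n))
    ≡⟨ cong₂ _+_ (sumTo-cong n λ {k} k≤n → cong (ℤ._* g (suc k))
                   (trans (cong (X^ (suc k)) (ℕₚ.+-∸-assoc 1 k≤n)) (X^-suc k (n ∸ k))))
                 (cong (λ j → X^ (suc (suc n)) j ℤ.* g (suc (suc n))) (ℕₚ.n∸n≡0 n)) ⟩
  dilate (g ∘ suc) n + 0ℤ
    ≡⟨ ℤₚ.+-identityʳ _ ⟩
  dilate (g ∘ suc) n ∎

dilate-shift : ∀ k (g : Series) → shift (k ℕ.+ k) (dilate g) ≗ dilate (shift k g)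
dilate-shift zero    g n = refl
dilate-shift (suc k) g n =
  trans (cong (λ j → shift (suc j) (dilate g) n) (ℕₚ.+-suc k k)) (shift₂ n)
  where
  shift₂ : ∀ n → shift (suc (suc (k ℕ.+ k))) (dilate g) n ≡ dilate (shift (suc k) g) n
  shift₂ zero          = sym (dilate-0 (shift (suc k) g))
  shift₂ (suc zero)    = sym (dilate-1 (shift (suc k) g))
  shift₂ (suc (suc n)) = trans (dilate-shift k g n) (sym (dilate-suc-suc (shift (suc k) g) n))

dilate-∇ : ∀ k (g : Series) → ∇ (k ℕ.+ k) (dilate g) ≗ dilate (∇ k g)
dilate-∇ k g n = begin
  dilate g n - shift (k ℕ.+ k) (dilate g) n ≡⟨ cong (λ x → dilate g n - x) (dilate-shift k g n) ⟩
  dilate g n - dilate (shift k g) n         ≡⟨ sym (dilate-sub g (shift k g) n) ⟩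
  dilate (∇ k g) n                          ∎

dilate-one : dilate one ≗ one
dilate-one zero          = dilate-0 one
dilate-one (suc zero)    = dilate-1 one
dilate-one (suc (suc n)) =
  trans (dilate-suc-suc one n) (sumTo-zero n (λ {k} _ → ℤₚ.*-zeroʳ (X^ k (n ∸ k))))

n∸k<k : ∀ {n k} → n / 2 < k → k ≤ n → n ∸ k < k
n∸k<k {n} {k} n/2<k k≤n = ℕₚ.≰⇒> (λ k≤n∸k → ℕₚ.<⇒≱ n/2<k (k≤n/2 k≤n∸k))
  where
  2k≤n : k ≤ n ∸ k → 2 * k ≤ n
  2k≤n k≤n∸k = ℕₚ.≤-trans (ℕₚ.+-monoʳ-≤ k (subst (_≤ n ∸ k) (sym (ℕₚ.+-identityʳ k)) k≤n∸k))
                          (ℕₚ.≤-reflexive (ℕₚ.m+[n∸m]≡n k≤n))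
  k≤n/2 : k ≤ n ∸ k → k ≤ n / 2
  k≤n/2 k≤n∸k = subst (_≤ n / 2) (m*n/n≡m k 2) (/-monoˡ-≤ 2 (subst (_≤ n) (ℕₚ.*-comm 2 k) (2k≤n k≤n∸k)))

module _ (m : ℕ) .{{_ : NonZero m}} where

  multiples : Series
  multiples t = + δ0 (t % m)

  multiples-0 : multiples 0 ≡ 1ℤ
  multiples-0 = cong (+_ ∘ δ0) (m<n⇒m%n≡m (ℕ.>-nonZero⁻¹ m))

  ∇-multiples : ∇ m multiples ≗ one
  ∇-multiples t with t ℕ.<? m
  ... | yes t<m = begin
    multiples t - shift m multiples t
      ≡⟨ cong₂ _-_ (cong (+_ ∘ δ0) (m<n⇒m%n≡m t<m)) (shift-below multiples t<m) ⟩
    + δ0 t - 0ℤ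
      ≡⟨ ℤₚ.+-identityʳ _ ⟩
    + δ0 t
      ≡⟨ +δ0≡one t ⟩
    one t ∎
  ... | no t≮m = subst (λ t → ∇ m multiples t ≡ one t) (ℕₚ.m+[n∸m]≡n (ℕₚ.≮⇒≥ t≮m)) (beyond (t ∸ m))
    where
    beyond : ∀ u → ∇ m multiples (m ℕ.+ u) ≡ one (m ℕ.+ u)
    beyond u = begin
      multiples (m ℕ.+ u) - shift m multiples (m ℕ.+ u)
        ≡⟨ cong₂ _-_ (cong (+_ ∘ δ0) (trans (cong (_% m) (ℕₚ.+-comm m u)) ([m+n]%n≡m%n u m)))
                     (shift-+ m multiples u) ⟩
      multiples u - multiples u
        ≡⟨ ℤₚ.+-inverseʳ (multiples u) ⟩
      0ℤ
        ≡⟨ sym (X^-off (λ 0≡m+u → ℕ.≢-nonZero⁻¹ m (ℕₚ.m+n≡0⇒m≡0 m (sym 0≡m+u)))) ⟩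
      one (m ℕ.+ u) ∎

  ∇-dilate-multiples : ∇ (2 * m) (dilate multiples) ≗ one
  ∇-dilate-multiples n = begin
    ∇ (2 * m) (dilate multiples) n  ≡⟨ cong (λ k → ∇ k (dilate multiples) n) (cong (m ℕ.+_) (ℕₚ.+-identityʳ m)) ⟩
    ∇ (m ℕ.+ m) (dilate multiples) n ≡⟨ dilate-∇ m multiples n ⟩
    dilate (∇ m multiples) n        ≡⟨ dilate-cong ∇-multiples n ⟩
    dilate one n                    ≡⟨ dilate-one n ⟩
    one n                           ∎

  mbinom-above : ∀ {n k} → n < k → mbinom m n k ≡ 0
  mbinom-above {zero}  {suc k} _         = refl
  mbinom-above {suc n} {suc k} (s≤s n<k) with suc k ℕ.≟ suc n
  ... | yes 1+k≡1+n = ⊥-elim (ℕₚ.<⇒≢ n<k (sym (ℕₚ.suc-injective 1+k≡1+n)))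
  ... | no _ with k ℕ.<? n
  ...   | yes k<n = ⊥-elim (ℕₚ.<-asym k<n n<k)
  ...   | no _    = refl

  mbinom-diag : ∀ k → mbinom m k k ≡ δ0 (k % m)
  mbinom-diag zero = cong δ0 (sym (m<n⇒m%n≡m (ℕ.>-nonZero⁻¹ m)))
  mbinom-diag (suc k) with suc k ℕ.≟ suc k
  ... | yes _   = refl
  ... | no k≢k = ⊥-elim (k≢k refl)

  mbinom-pascal : ∀ {n k} → k < n → mbinom m (suc n) (suc k) ≡ mbinom m n (suc k) ℕ.+ mbinom m n k
  mbinom-pascal {n} {k} k<n with suc k ℕ.≟ suc n
  ... | yes 1+k≡1+n = ⊥-elim (ℕₚ.<⇒≢ k<n (ℕₚ.suc-injective 1+k≡1+n))
  ... | no _ with k ℕ.<? n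
  ...   | yes _   = refl
  ...   | no k≮n = ⊥-elim (k≮n k<n)

  mbinom-pascalℤ : ∀ s k → + mbinom m (suc s) (suc k)
                   ≡ + mbinom m s (suc k) + + mbinom m s k + X^ k s ℤ.* (multiples (suc k) - multiples k)
  mbinom-pascalℤ s k with ℕₚ.<-cmp k s
  ... | tri< k<s _ _ =
    trans (cong +_ (mbinom-pascal k<s))
          (trans (ℤₚ.pos-+ (mbinom m s (suc k)) (mbinom m s k)) (sym (+-X^-off (ℕₚ.<⇒≢ k<s) _ _)))
  ... | tri> _ _ s<k =
    trans (cong +_ (mbinom-above (s≤s s<k)))
          (sym (trans (+-X^-off (ℕₚ.>⇒≢ s<k) _ _)
                      (cong₂ (λ x y → + x + + y) (mbinom-above (ℕₚ.m<n⇒m<1+n s<k)) (mbinom-above s<k))))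
  ... | tri≈ _ refl _ = begin
    + mbinom m (suc k) (suc k)
      ≡⟨ cong +_ (mbinom-diag (suc k)) ⟩
    multiples (suc k)
      ≡⟨ jump (multiples (suc k)) (multiples k) ⟩
    0ℤ + multiples k + 1ℤ ℤ.* (multiples (suc k) - multiples k)
      ≡⟨ cong₂ (λ x y → + x + + y + 1ℤ ℤ.* (multiples (suc k) - multiples k))
               (sym (mbinom-above (ℕₚ.n<1+n k))) (sym (mbinom-diag k)) ⟩
    + mbinom m k (suc k) + + mbinom m k k + 1ℤ ℤ.* (multiples (suc k) - multiples k)
      ≡⟨ cong (λ x → + mbinom m k (suc k) + + mbinom m k k + x ℤ.* (multiples (suc k) - multiples k))
              (sym (X^-diag k)) ⟩
    + mbinom m k (suc k) + + mbinom m k k + X^ k k ℤ.* (multiples (suc k) - multiples k) ∎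
    where
    jump : ∀ x y → x ≡ 0ℤ + y + 1ℤ ℤ.* (x - y)
    jump = solve-∀

  antidiagSum : ℕ → ℤ
  antidiagSum n = sumTo n (λ k → + mbinom m (n ∸ k) k)

  -- The terms past n / 2 vanish, so each antidiagonal may be summed up to n; this makes the
  -- recurrence below uniform in the parity of n.
  antidiag≡antidiagSum : ∀ n → antidiag m n ≡ antidiagSum n
  antidiag≡antidiagSum n =
    sumTo-extend _ (m/n≤m n 2) (λ n/2<k k≤n → cong +_ (mbinom-above (n∸k<k n/2<k k≤n)))

  antidiagSum-rec : ∀ n → antidiagSum (suc (suc n))
                    ≡ antidiagSum (suc n) + antidiagSum n + dilate ((multiples ∘ suc) ⊕ ⊖ multiples) n
  antidiagSum-rec n = begin
    antidiagSum (suc (suc n))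
      ≡⟨ sumTo-head (suc n) _ ⟩
    1ℤ + (sumTo n next + + mbinom m (n ∸ n) (suc (suc n)))
      ≡⟨ cong (λ x → 1ℤ + (sumTo n next + + mbinom m x (suc (suc n))))
              (ℕₚ.n∸n≡0 n) ⟩
    1ℤ + (sumTo n next + 0ℤ)
      ≡⟨ cong (λ x → 1ℤ + x) (ℤₚ.+-identityʳ (sumTo n next)) ⟩
    1ℤ + sumTo n next
      ≡⟨ cong (λ x → 1ℤ + x) (sumTo-cong n λ {k} k≤n →
           trans (cong (λ j → + mbinom m j (suc k)) (ℕₚ.+-∸-assoc 1 k≤n)) (mbinom-pascalℤ (n ∸ k) k)) ⟩
    1ℤ + sumTo n (λ k → above k + diagonal k + correction k)
      ≡⟨ cong (λ x → 1ℤ + x) (trans (sumTo-+ n _ _) (cong (_+ dilate jumps n) (sumTo-+ n _ _))) ⟩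
    1ℤ + (sumTo n above + antidiagSum n + dilate jumps n)
      ≡⟨ reassoc 1ℤ (sumTo n above) (antidiagSum n) (dilate jumps n) ⟩
    1ℤ + sumTo n above + antidiagSum n + dilate jumps n
      ≡⟨ cong (λ x → x + antidiagSum n + dilate jumps n) (sym (sumTo-head n _)) ⟩
    antidiagSum (suc n) + antidiagSum n + dilate jumps n ∎
    where
    jumps : Series
    jumps = (multiples ∘ suc) ⊕ ⊖ multiples
    next above diagonal correction : ℕ → ℤ
    next k = + mbinom m (suc n ∸ k) (suc k)
    above k = + mbinom m (n ∸ k) (suc k)
    diagonal k = + mbinom m (n ∸ k) k
    correction k = X^ k (n ∸ k) ℤ.* jumps k
    reassoc : ∀ a b c d → a + (b + c + d) ≡ a + b + c + d
    reassoc = solve-∀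

  antidiag-⊛-1-x-x² : antidiag m ⊛ (one ⊕ ⊖ X^ 1 ⊕ ⊖ X^ 2) ≗ ∇ 2 (dilate multiples)
  antidiag-⊛-1-x-x² zero =
    trans (⊛-by-1-x-x² (antidiag m) 0)
          (sym (trans (ℤₚ.+-identityʳ _) (trans (dilate-0 multiples) multiples-0)))
  antidiag-⊛-1-x-x² (suc zero) = ⊛-by-1-x-x² (antidiag m) 1
  antidiag-⊛-1-x-x² (suc (suc n)) = begin
    (antidiag m ⊛ (one ⊕ ⊖ X^ 1 ⊕ ⊖ X^ 2)) (suc (suc n))
      ≡⟨ ⊛-by-1-x-x² (antidiag m) (suc (suc n)) ⟩
    antidiag m (suc (suc n)) - antidiag m (suc n) - antidiag m n
      ≡⟨ cong₂ _-_ (cong₂ _-_ (antidiag≡antidiagSum (suc (suc n))) (antidiag≡antidiagSum (suc n)))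
                   (antidiag≡antidiagSum n) ⟩
    antidiagSum (suc (suc n)) - antidiagSum (suc n) - antidiagSum n
      ≡⟨ cong (λ x → x - antidiagSum (suc n) - antidiagSum n) (antidiagSum-rec n) ⟩
    antidiagSum (suc n) + antidiagSum n + dilate ((multiples ∘ suc) ⊕ ⊖ multiples) n - antidiagSum (suc n) - antidiagSum n
      ≡⟨ cancel (antidiagSum (suc n)) (antidiagSum n) _ ⟩
    dilate ((multiples ∘ suc) ⊕ ⊖ multiples) n
      ≡⟨ dilate-sub (multiples ∘ suc) multiples n ⟩
    dilate (multiples ∘ suc) n - dilate multiples n
      ≡⟨ cong (_- dilate multiples n) (sym (dilate-suc-suc multiples n)) ⟩
    ∇ 2 (dilate multiples) (suc (suc n)) ∎
    where
    cancel : ∀ a b c → a + b + c - a - b ≡ c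
    cancel = solve-∀

corollary6 : (m : ℕ) → .{{_ : NonZero m}} →
    ((n : ℕ) → (antidiag m ⊛ ((one ⊕ ⊖ X^ (2 * m)) ⊛ (one ⊕ ⊖ X^ 1 ⊕ ⊖ X^ 2))) n
                 ≡ (one ⊕ ⊖ X^ 2) n)
    × ((n : ℕ) → (antidiag m ⊛ (evenGeom m ⊛ (one ⊕ ⊖ X^ 1 ⊕ ⊖ X^ 2))) n ≡ one n)
corollary6 m = quotient₁ , quotient₂
  where
  quotient₁ : ∀ n → (antidiag m ⊛ ((one ⊕ ⊖ X^ (2 * m)) ⊛ (one ⊕ ⊖ X^ 1 ⊕ ⊖ X^ 2))) n ≡ (one ⊕ ⊖ X^ 2) n
  quotient₁ n = begin
    (antidiag m ⊛ ((one ⊕ ⊖ X^ (2 * m)) ⊛ (one ⊕ ⊖ X^ 1 ⊕ ⊖ X^ 2))) n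
      ≡⟨ ⊛-congʳ (antidiag m) (one-X^-⊛ (2 * m) (one ⊕ ⊖ X^ 1 ⊕ ⊖ X^ 2)) n ⟩
    (antidiag m ⊛ ∇ (2 * m) (one ⊕ ⊖ X^ 1 ⊕ ⊖ X^ 2)) n
      ≡⟨ ⊛-∇ʳ (2 * m) (antidiag m) (one ⊕ ⊖ X^ 1 ⊕ ⊖ X^ 2) n ⟩
    ∇ (2 * m) (antidiag m ⊛ (one ⊕ ⊖ X^ 1 ⊕ ⊖ X^ 2)) n
      ≡⟨ ∇-cong (2 * m) (antidiag-⊛-1-x-x² m) n ⟩
    ∇ (2 * m) (∇ 2 (dilate (multiples m))) n
      ≡⟨ ∇-comm (2 * m) 2 (dilate (multiples m)) n ⟩
    ∇ 2 (∇ (2 * m) (dilate (multiples m))) n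
      ≡⟨ ∇-cong 2 (∇-dilate-multiples m) n ⟩
    ∇ 2 one n
      ≡⟨ cong (λ x → one n - x) (sym (X^≗shift-one 2 n)) ⟩
    (one ⊕ ⊖ X^ 2) n ∎
  quotient₂ : ∀ n → (antidiag m ⊛ (evenGeom m ⊛ (one ⊕ ⊖ X^ 1 ⊕ ⊖ X^ 2))) n ≡ one n
  quotient₂ n = trans (⊛-evenGeom-⊛ m (antidiag m) (one ⊕ ⊖ X^ 1 ⊕ ⊖ X^ 2) (dilate (multiples m))
                                     (antidiag-⊛-1-x-x² m) n)
                      (∇-dilate-multiples m n)
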